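{- Let $p$ be a prime, let $n,k$ be positive integers and $a\in\mathbb{F}_p$. If $x^n(x^k+a)$ is a nontrivial permutation binomial over $\mathbb{F}_p$, then $\gcd(k,p-1)\neq 4$.
   Context: A polynomial $f\in\mathbb{F}_p[x]$ is a permutation polynomial over $\mathbb{F}_p$ if the map $c\mapsto f(c)$ is a bijection of $\mathbb{F}_p$. A permutation binomial of $\mathbb{F}_p$ is called trivial if it is congruent modulo $x^p-x$ to the sum of a constant and a monomial; equivalently, the nontrivial permutation binomials are those binomials (two terms with nonzero coefficients) permuting $\mathbb{F}_p$ whose two terms have positive degrees that are incongruent modulo $p-1$. -}

module Defs where

open import Data.Nat using (ℕ; zero; suc; _+_; _*_; _^_; _%_; NonZero)
open import Data.Nat.Divisibility using (_∣_)
open import Data.Fin using (Fin; toℕ; fromℕ<)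
open import Data.Nat.DivMod using (m%n<n)
open import Data.Product using (_×_)
open import Relation.Binary.PropositionalEquality using (_≡_)
open import Relation.Nullary using (¬_)
open import Function.Definitions using (Bijective)

-- The prime field F_p is modelled as Fin p (residues 0,…,p-1);
-- arithmetic is done in ℕ and reduced mod p.

evalBinom : (p : ℕ) .{{_ : NonZero p}} → (n k : ℕ) → Fin p → Fin p → Fin p
evalBinom p n k a c =
  fromℕ< (m%n<n (toℕ c ^ (n + k) + toℕ a * toℕ c ^ n) p)

IsPermPoly : (p : ℕ) → (Fin p → Fin p) → Set
IsPermPoly p f = Bijective {A = Fin p} _≡_ _≡_ f

-- x^n (x^k + a) = x^(n+k) + a x^n is a nontrivial permutation binomial of F_p:
-- both coefficients nonzero (a ≠ 0), the degrees n+k and n are positive and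
-- incongruent modulo p-1 (i.e. (p-1) ∤ k), and it permutes F_p.
-- (Positivity of n, k is assumed separately in the theorem.)
NontrivialPermBinom : (p : ℕ) .{{_ : NonZero p}} → (n k : ℕ) → Fin p → Set
NontrivialPermBinom p n k a =
  ¬ (toℕ a ≡ 0) × ¬ ((p Data.Nat.∸ 1) ∣ k) × IsPermPoly p (evalBinom p n k a)

{-# OPTIONS --safe #-}
-- Write p − 1 = 4e and k = 4k₁, so that gcd(k₁, e) = 1. If x ↦ xⁿ(xᵏ + a) permutes 𝔽_p, then the
-- sum of its t-th powers over 𝔽_p equals ∑ xᵗ, which vanishes for 0 < t < p − 1. Expanding
-- (xⁿ(xᵏ + a))ᵗ and using that ∑ xᵐ is p − 1 ≡ −1 when (p − 1) ∣ m > 0 and 0 otherwise, this sum is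
-- −∑ C(t, j) a^(t−j) over the j ≤ t with (p − 1) ∣ n t + k j. When t = 4s these j are exactly those
-- congruent mod e to the least root j₀(s) of s n + k₁ j ≡ 0, and for e ≥ 5 some s < e has
-- j₀(s) ≤ 4s < j₀(s) + e, making j₀(s) the only one; its term C(t, j₀) a^(t−j₀) is nonzero mod p.
-- Of the remaining primes, p − 1 = 4 would divide k, 9 is not prime, and for p = 13, 17 an exhaustive
-- search, after reducing n and k modulo p − 1, finds two points with equal values.
module Submission where

open import Data.Fin.Base as Fin using (Fin; toℕ; fromℕ; fromℕ<; inject₁; punchIn)
open import Data.Fin.Properties
  using (toℕ<n; toℕ-fromℕ; toℕ-fromℕ<; toℕ-inject₁; toℕ-injective; punchInᵢ≢i; any?; all?)
  renaming (_≟_ to _≟ᶠ_)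
open import Data.List.Base using (_∷_; [])
open import Data.Nat
open import Data.Nat.Combinatorics
open import Data.Nat.Combinatorics.Specification using (nCk≡n!/k![n-k]!)
open import Data.Nat.Coprimality as Coprimality
  using (Coprime; coprime-divisor; coprime-Bézout; prime⇒coprime; gcd≡1⇒coprime)
open import Data.Nat.Divisibility
open import Data.Nat.DivMod
open import Data.Nat.GCD
  using (module Bézout; gcd; gcd-greatest; gcd-universality; gcd[m,n]∣m; gcd[m,n]∣n; c*gcd[m,n]≡gcd[cm,cn])
open import Data.Nat.Induction using (<-rec)
open import Data.Nat.Primality
  using (Prime; euclidsLemma; prime⇒nonZero; prime⇒nonTrivial; prime⇒¬composite; composite-≢)
open import Data.Nat.Properties
open import Data.Nat.Tactic.RingSolver using (solve)
open import Data.Product.Base using (_,_; _×_; ∃; ∃₂; proj₁; proj₂)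
open import Data.Sum.Base using (_⊎_; inj₁; inj₂; [_,_]′)
open import Data.Vec.Functional using (removeAt)
open import Function.Base using (_∘_; flip; id)
open import Function.Bundles using (mk⤖)
open import Function.Definitions using (Bijective)
open import Function.Properties.Bijection using (⤖⇒↔)
open import Relation.Binary.Bundles using (Setoid)
open import Relation.Binary.PropositionalEquality
open import Relation.Binary.Structures using (IsEquivalence)
open import Relation.Nullary.Decidable using (Dec; yes; no; ¬?; _×-dec_; _→-dec_; toWitness)
open import Relation.Nullary.Negation using (¬_; contradiction)
open import Relation.Unary using (Decidable)

open import Algebra.Properties.CommutativeMonoid.Sum +-0-commutativeMonoid
  using (sum; sum-syntax; sum⁺-syntax; sum-remove; sum-init-last; sum-cong-≗; ∑-comm; sum-permute)
open import Algebra.Properties.CommutativeSemigroup *-commutativeSemigroup using (x∙yz≈y∙xz; x∙yz≈z∙xy)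
open import Algebra.Properties.Semiring.Sum +-*-semiring using (*-distribˡ-sum)
import Algebra.Definitions.RawSemiring as RawSemiringDefinitions
import Algebra.Properties.CommutativeSemiring.Binomial as Binomial
import Relation.Binary.Reasoning.Setoid as SetoidReasoning

open import Defs

module Modulo (m : ℕ) .{{_ : NonZero m}} where

  infix 4 _≈_

  -- A record rather than  x % m ≡ y % m,  so that x and y can be inferred.
  record _≈_ (x y : ℕ) : Set where
    constructor mk≈
    field %-≡ : x % m ≡ y % m

  open _≈_ public

  ≈-isEquivalence : IsEquivalence _≈_
  ≈-isEquivalence = record
    { refl  = mk≈ refl
    ; sym   = λ x≈y → mk≈ (sym (%-≡ x≈y))
    ; trans = λ x≈y y≈z → mk≈ (trans (%-≡ x≈y) (%-≡ y≈z))
    }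

  ≈-setoid : Setoid _ _
  ≈-setoid = record { isEquivalence = ≈-isEquivalence }

  open IsEquivalence ≈-isEquivalence public
    renaming (refl to ≈-refl; sym to ≈-sym; trans to ≈-trans)

  module ≈-Reasoning = SetoidReasoning ≈-setoid

  ≡⇒≈ : ∀ {x y} → x ≡ y → x ≈ y
  ≡⇒≈ refl = ≈-refl

  x%m≈x : ∀ x → x % m ≈ x
  x%m≈x x = mk≈ (m%n%n≡m%n x m)

  +-cong : ∀ {x y u v} → x ≈ y → u ≈ v → x + u ≈ y + v
  +-cong {x} {y} {u} {v} (mk≈ x≈y) (mk≈ u≈v) = mk≈ (begin
    (x + u) % m             ≡⟨ %-distribˡ-+ x u m ⟩
    (x % m + u % m) % m     ≡⟨ cong₂ (λ a b → (a + b) % m) x≈y u≈v ⟩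
    (y % m + v % m) % m     ≡⟨ %-distribˡ-+ y v m ⟨
    (y + v) % m             ∎)
    where open ≡-Reasoning

  *-cong : ∀ {x y u v} → x ≈ y → u ≈ v → x * u ≈ y * v
  *-cong {x} {y} {u} {v} (mk≈ x≈y) (mk≈ u≈v) = mk≈ (begin
    (x * u) % m             ≡⟨ %-distribˡ-* x u m ⟩
    (x % m * (u % m)) % m   ≡⟨ cong₂ (λ a b → (a * b) % m) x≈y u≈v ⟩
    (y % m * (v % m)) % m   ≡⟨ %-distribˡ-* y v m ⟨
    (y * v) % m             ∎)
    where open ≡-Reasoning

  ^-cong : ∀ {x y} n → x ≈ y → x ^ n ≈ y ^ n
  ^-cong zero    x≈y = ≈-refl
  ^-cong (suc n) x≈y = *-cong x≈y (^-cong n x≈y)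

  *-zeroʳ-≈ : ∀ x {y} → y ≈ 0 → x * y ≈ 0
  *-zeroʳ-≈ x y≈0 = ≈-trans (*-cong (≈-refl {x}) y≈0) (≡⇒≈ (*-zeroʳ x))

  private
    0%m≡0 : 0 % m ≡ 0
    0%m≡0 = n∣m⇒m%n≡0 0 m (divides 0 refl)

  ∣⇒≈0 : ∀ {x} → m ∣ x → x ≈ 0
  ∣⇒≈0 {x} m∣x = mk≈ (trans (n∣m⇒m%n≡0 x m m∣x) (sym 0%m≡0))

  ≈0⇒∣ : ∀ {x} → x ≈ 0 → m ∣ x
  ≈0⇒∣ {x} (mk≈ x≈0) = m%n≡0⇒n∣m x m (trans x≈0 0%m≡0)

  ≈⇒∣∸ : ∀ {x y} → x ≈ y → m ∣ x ∸ y
  ≈⇒∣∸ {x} {y} (mk≈ x≈y) = divides (x / m ∸ y / m) (begin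
    x ∸ y                                       ≡⟨ cong₂ _∸_ (m≡m%n+[m/n]*n x m) (m≡m%n+[m/n]*n y m) ⟩
    (x % m + x / m * m) ∸ (y % m + y / m * m)   ≡⟨ cong (λ r → (r + x / m * m) ∸ (y % m + y / m * m)) x≈y ⟩
    (y % m + x / m * m) ∸ (y % m + y / m * m)   ≡⟨ [m+n]∸[m+o]≡n∸o (y % m) _ _ ⟩
    x / m * m ∸ y / m * m                       ≡⟨ *-distribʳ-∸ m (x / m) (y / m) ⟨
    (x / m ∸ y / m) * m                         ∎)
    where open ≡-Reasoning

  ∣∸⇒≈ : ∀ {x y} → y ≤ x → m ∣ x ∸ y → x ≈ y
  ∣∸⇒≈ {x} {y} y≤x m∣x∸y = mk≈ (begin
    x % m             ≡⟨ cong (_% m) (m∸n+n≡m y≤x) ⟨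
    (x ∸ y + y) % m   ≡⟨ %-remove-+ˡ y m∣x∸y ⟩
    y % m             ∎)
    where open ≡-Reasoning

  ∣∸∧∣∸⇒≈ : ∀ {x y} → m ∣ x ∸ y → m ∣ y ∸ x → x ≈ y
  ∣∸∧∣∸⇒≈ {x} {y} m∣x∸y m∣y∸x with ≤-total x y
  ... | inj₁ x≤y = ≈-sym (∣∸⇒≈ x≤y m∣y∸x)
  ... | inj₂ y≤x = ∣∸⇒≈ y≤x m∣x∸y

  +-cancelˡ : ∀ x {y z} → x + y ≈ x + z → y ≈ z
  +-cancelˡ x {y} {z} x+y≈x+z = ∣∸∧∣∸⇒≈
    (subst (m ∣_) ([m+n]∸[m+o]≡n∸o x y z) (≈⇒∣∸ x+y≈x+z))
    (subst (m ∣_) ([m+n]∸[m+o]≡n∸o x z y) (≈⇒∣∸ (≈-sym x+y≈x+z)))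

  *-cancelˡ : ∀ {c x y} → Coprime m c → c * x ≈ c * y → x ≈ y
  *-cancelˡ {c} {x} {y} coprime cx≈cy = ∣∸∧∣∸⇒≈ (cancel x y cx≈cy) (cancel y x (≈-sym cx≈cy))
    where
    cancel : ∀ u v → c * u ≈ c * v → m ∣ u ∸ v
    cancel u v cu≈cv = coprime-divisor coprime (subst (m ∣_) (sym (*-distribˡ-∸ c u v)) (≈⇒∣∸ cu≈cv))

  ≈⇒≡ : ∀ {x y} → x ≈ y → y < m → x < y + m → x ≡ y
  ≈⇒≡ {x} {y} (mk≈ x≈y) y<m x<y+m with x / m in x/m≡
  ... | zero  = begin
    x                  ≡⟨ m≡m%n+[m/n]*n x m ⟩
    x % m + x / m * m  ≡⟨ cong₂ (λ r q → r + q * m) x≈y x/m≡ ⟩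
    y % m + 0          ≡⟨ +-identityʳ _ ⟩
    y % m              ≡⟨ m<n⇒m%n≡m y<m ⟩
    y                  ∎
    where open ≡-Reasoning
  ... | suc q = contradiction y+m≤x (<⇒≱ x<y+m)
    where
    open ≤-Reasoning
    y+m≤x : y + m ≤ x
    y+m≤x = begin
      y + m              ≤⟨ +-monoʳ-≤ y (m≤m+n m (q * m)) ⟩
      y + suc q * m      ≡⟨ cong₂ (λ r q′ → r + q′ * m) (trans (sym (m<n⇒m%n≡m y<m)) (sym x≈y)) (sym x/m≡) ⟩
      x % m + x / m * m  ≡⟨ m≡m%n+[m/n]*n x m ⟨
      x                  ∎

  sum-cong : ∀ {n} {f g : Fin n → ℕ} → (∀ i → f i ≈ g i) → sum f ≈ sum g
  sum-cong {zero}  f≈g = ≈-refl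
  sum-cong {suc n} f≈g = +-cong (f≈g _) (sum-cong (λ i → f≈g (Fin.suc i)))

  sum-≈0 : ∀ {n} {f : Fin n → ℕ} → (∀ i → f i ≈ 0) → sum f ≈ 0
  sum-≈0 {zero}  f≈0 = ≈-refl
  sum-≈0 {suc n} f≈0 = +-cong (f≈0 _) (sum-≈0 (λ i → f≈0 (Fin.suc i)))

  sum-single : ∀ {n} (f : Fin (suc n) → ℕ) i → (∀ j → j ≢ i → f j ≈ 0) → sum f ≈ f i
  sum-single f i others = begin
    sum f                      ≡⟨ sum-remove {i = i} f ⟩
    f i + sum (removeAt f i)   ≈⟨ +-cong ≈-refl (sum-≈0 (λ j → others (punchIn i j) (punchInᵢ≢i i j))) ⟩
    f i + 0                    ≡⟨ +-identityʳ (f i) ⟩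
    f i                        ∎
    where open ≈-Reasoning

∑1≡n : ∀ n → ∑[ i < n ] 1 ≡ n
∑1≡n zero    = refl
∑1≡n (suc n) = cong suc (∑1≡n n)

∑-bijection : ∀ {n} {f : Fin n → Fin n} → Bijective _≡_ _≡_ f → (g : Fin n → ℕ) →
              ∑[ x < n ] g (f x) ≡ ∑[ x < n ] g x
∑-bijection bij g = sym (sum-permute g (⤖⇒↔ (mk⤖ bij)))

^-distribʳ-* : ∀ x y n → (x * y) ^ n ≡ x ^ n * y ^ n
^-distribʳ-* x y zero    = refl
^-distribʳ-* x y (suc n) = begin
  x * y * (x * y) ^ n       ≡⟨ cong (x * y *_) (^-distribʳ-* x y n) ⟩
  x * y * (x ^ n * y ^ n)   ≡⟨ [m*n]*[o*p]≡[m*o]*[n*p] x y (x ^ n) (y ^ n) ⟩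
  x * x ^ n * (y * y ^ n)   ∎
  where open ≡-Reasoning

private
  module ℕ-Binomial = Binomial +-*-commutativeSemiring
  open RawSemiringDefinitions +-*-rawSemiring using () renaming (_^_ to _^ᴿ_; _×_ to _×ᴿ_)

  ^ᴿ≡^ : ∀ x n → x ^ᴿ n ≡ x ^ n
  ^ᴿ≡^ x zero    = refl
  ^ᴿ≡^ x (suc n) = cong (x *_) (^ᴿ≡^ x n)

  ×ᴿ≡* : ∀ n x → n ×ᴿ x ≡ n * x
  ×ᴿ≡* zero    x = refl
  ×ᴿ≡* (suc n) x = cong (x +_) (×ᴿ≡* n x)

binomial-theorem : ∀ n x y → (x + y) ^ n ≡ ∑[ i ≤ n ] ((n C toℕ i) * (x ^ toℕ i * y ^ (n ∸ toℕ i)))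
binomial-theorem n x y = begin
  (x + y) ^ n                          ≡⟨ ^ᴿ≡^ (x + y) n ⟨
  (x + y) ^ᴿ n                         ≡⟨ ℕ-Binomial.theorem n x y ⟩
  ℕ-Binomial.binomialExpansion x y n   ≡⟨ sum-cong-≗ {suc n} term ⟩
  ∑[ i ≤ n ] ((n C toℕ i) * (x ^ toℕ i * y ^ (n ∸ toℕ i))) ∎
  where
  open ≡-Reasoning
  term : ∀ i → ℕ-Binomial.binomialTerm x y n i ≡ (n C toℕ i) * (x ^ toℕ i * y ^ (n ∸ toℕ i))
  term i = trans (×ᴿ≡* (n C toℕ i) _)
                 (cong ((n C toℕ i) *_) (cong₂ _*_ (^ᴿ≡^ x (toℕ i)) (^ᴿ≡^ y (n ∸ toℕ i))))

[x^[n+k]+a*x^n]^t≡∑ : ∀ n k a t x →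
  (x ^ (n + k) + a * x ^ n) ^ t ≡ ∑[ j ≤ t ] ((t C toℕ j) * (a ^ (t ∸ toℕ j) * x ^ (n * t + k * toℕ j)))
[x^[n+k]+a*x^n]^t≡∑ n k a t x = begin
  (x ^ (n + k) + a * x ^ n) ^ t                           ≡⟨ cong (_^ t) factor ⟩
  (x ^ n * (x ^ k + a)) ^ t                               ≡⟨ ^-distribʳ-* (x ^ n) (x ^ k + a) t ⟩
  (x ^ n) ^ t * (x ^ k + a) ^ t                           ≡⟨ cong ((x ^ n) ^ t *_) (binomial-theorem t (x ^ k) a) ⟩
  (x ^ n) ^ t * ∑[ j ≤ t ] binomialTerm j                 ≡⟨ *-distribˡ-sum {suc t} ((x ^ n) ^ t) binomialTerm ⟩
  ∑[ j ≤ t ] ((x ^ n) ^ t * binomialTerm j)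
    ≡⟨ sum-cong-≗ {suc t} (λ j → term (t C toℕ j) (toℕ j) (a ^ (t ∸ toℕ j))) ⟩
  ∑[ j ≤ t ] ((t C toℕ j) * (a ^ (t ∸ toℕ j) * x ^ (n * t + k * toℕ j))) ∎
  where
  open ≡-Reasoning
  binomialTerm : Fin (suc t) → ℕ
  binomialTerm j = (t C toℕ j) * ((x ^ k) ^ toℕ j * a ^ (t ∸ toℕ j))
  factor : x ^ (n + k) + a * x ^ n ≡ x ^ n * (x ^ k + a)
  factor = begin
    x ^ (n + k) + a * x ^ n     ≡⟨ cong₂ _+_ (^-distribˡ-+-* x n k) (*-comm a (x ^ n)) ⟩
    x ^ n * x ^ k + x ^ n * a   ≡⟨ *-distribˡ-+ (x ^ n) (x ^ k) a ⟨
    x ^ n * (x ^ k + a)         ∎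
  term : ∀ c j b → (x ^ n) ^ t * (c * ((x ^ k) ^ j * b)) ≡ c * (b * x ^ (n * t + k * j))
  term c j b = begin
    (x ^ n) ^ t * (c * ((x ^ k) ^ j * b))
      ≡⟨ cong₂ (λ u v → u * (c * (v * b))) (^-*-assoc x n t) (^-*-assoc x k j) ⟩
    x ^ (n * t) * (c * (x ^ (k * j) * b))   ≡⟨ x∙yz≈y∙xz (x ^ (n * t)) c _ ⟩
    c * (x ^ (n * t) * (x ^ (k * j) * b))   ≡⟨ cong (c *_) (x∙yz≈z∙xy (x ^ (n * t)) (x ^ (k * j)) b) ⟩
    c * (b * (x ^ (n * t) * x ^ (k * j)))   ≡⟨ cong (λ u → c * (b * u)) (^-distribˡ-+-* x (n * t) (k * j)) ⟨
    c * (b * x ^ (n * t + k * j))           ∎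

module _ {p} (p-prime : Prime p) where

  private instance
    _ = prime⇒nonZero p-prime
    _ = prime⇒nonTrivial p-prime

  prime-∤-* : ∀ {a b} → p ∤ a → p ∤ b → p ∤ a * b
  prime-∤-* {a} {b} p∤a p∤b p∣ab = [ p∤a , p∤b ]′ (euclidsLemma a b p-prime p∣ab)

  prime-∤-^ : ∀ {a} n → p ∤ a → p ∤ a ^ n
  prime-∤-^ zero    p∤a = >⇒∤ (nonTrivial⇒n>1 p)
  prime-∤-^ (suc n) p∤a = prime-∤-* p∤a (prime-∤-^ n p∤a)

  prime-∤-! : ∀ {n} → n < p → p ∤ n !
  prime-∤-! {zero}  _     = >⇒∤ (nonTrivial⇒n>1 p)
  prime-∤-! {suc n} n+1<p = prime-∤-* (>⇒∤ n+1<p) (prime-∤-! (<-trans (n<1+n n) n+1<p))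

  private
    C*k!*[n∸k]!≡n! : ∀ {n k} → k ≤ n → (n C k) * (k ! * (n ∸ k) !) ≡ n !
    C*k!*[n∸k]!≡n! {n} {k} k≤n = trans (cong (_* (k ! * (n ∸ k) !)) (nCk≡n!/k![n-k]! k≤n))
                                       (m/n*n≡m {{k !* (n ∸ k) !≢0}} (k![n∸k]!∣n! k≤n))

  prime-∤-C : ∀ {n k} → k ≤ n → n < p → p ∤ n C k
  prime-∤-C {n} {k} k≤n n<p p∣nCk =
    prime-∤-! n<p (subst (p ∣_) (C*k!*[n∸k]!≡n! k≤n) (∣m⇒∣m*n _ p∣nCk))

  prime-∣-C : ∀ {k} → 0 < k → k < p → p ∣ p C k
  prime-∣-C {k} 0<k k<p =
    [ id , flip contradiction p∤k!*[p∸k]! ]′ (euclidsLemma (p C k) _ p-prime p∣C*k!*[p∸k]!)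
    where
    p∤k!*[p∸k]! : p ∤ k ! * (p ∸ k) !
    p∤k!*[p∸k]! = prime-∤-* (prime-∤-! k<p) (prime-∤-! (∸-monoʳ-< 0<k (<⇒≤ k<p)))
    n∣n! : ∀ n → .{{NonZero n}} → n ∣ n !
    n∣n! (suc n) = m∣m*n (n !)
    p∣C*k!*[p∸k]! : p ∣ (p C k) * (k ! * (p ∸ k) !)
    p∣C*k!*[p∸k]! = subst (p ∣_) (sym (C*k!*[n∸k]!≡n! (<⇒≤ k<p))) (n∣n! p)

-- x^(n t + k j) is the j-th monomial of (xⁿ(xᵏ + a))ᵗ.
record UniqueSolution (m n k : ℕ) : Set where
  field
    t j₀     : ℕ
    1≤t      : 1 ≤ t
    t<m      : t < m
    j₀≤t     : j₀ ≤ t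
    solution : m ∣ n * t + k * j₀
    unique   : ∀ j → j ≤ t → m ∣ n * t + k * j → j ≡ j₀

Collision : ∀ {n} → (Fin n → Fin n) → Set
Collision f = ∃₂ λ c d → c ≢ d × f c ≡ f d

collision? : ∀ {n} (f : Fin n → Fin n) → Dec (Collision f)
collision? f = any? λ c → any? λ d → ¬? (c ≟ᶠ d) ×-dec (f c ≟ᶠ f d)

collision⇒¬bijective : ∀ {n} {f g : Fin n → Fin n} → f ≗ g → Collision g → ¬ Bijective _≡_ _≡_ f
collision⇒¬bijective f≗g (c , d , c≢d , gc≡gd) (injective , _) =
  c≢d (injective (trans (f≗g c) (trans gc≡gd (sym (f≗g d)))))

ReducedCollisions : ℕ → Set
ReducedCollisions p-1 = ∀ (N K : Fin p-1) (a : Fin (suc p-1)) → gcd (toℕ K) p-1 ≡ 4 → toℕ a ≢ 0 →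
                        Collision (evalBinom (suc p-1) (suc (toℕ N)) (toℕ K) a)

reducedCollisions? : ∀ p-1 → Dec (ReducedCollisions p-1)
reducedCollisions? p-1 = all? λ N → all? λ K → all? λ a →
  (gcd (toℕ K) p-1 ≟ 4) →-dec (¬? (toℕ a ≟ 0) →-dec collision? _)

gcd[m%n,n]≡gcd[m,n] : ∀ m n .{{_ : NonZero n}} → gcd (m % n) n ≡ gcd m n
gcd[m%n,n]≡gcd[m,n] m n = gcd-universality
  (λ (d∣m , d∣n) → gcd-greatest (%-presˡ-∣ d∣m d∣n) d∣n)
  (λ d∣g → let d∣n = ∣-trans d∣g (gcd[m,n]∣n (m % n) n) in
           ∣n∣m%n⇒∣m d∣n (∣-trans d∣g (gcd[m,n]∣m (m % n) n)) , d∣n)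

module PrimeField {p-1 : ℕ} (p-prime : Prime (suc p-1)) where

  p : ℕ
  p = suc p-1

  open Modulo p

  instance
    p-1-nonZero : NonZero p-1
    p-1-nonZero = >-nonZero (s≤s⁻¹ (nonTrivial⇒n>1 p {{prime⇒nonTrivial p-prime}}))

  prime∤⇒coprime : ∀ {c} → p ∤ c → Coprime p c
  prime∤⇒coprime {c} p∤c (d∣p , d∣c) =
    prime⇒coprime p-prime {{≢-nonZero c%p≢0}} (m%n<n c p) (d∣p , %-presˡ-∣ d∣c d∣p)
    where
    c%p≢0 : c % p ≢ 0
    c%p≢0 c%p≡0 = p∤c (m%n≡0⇒n∣m c p c%p≡0)

  ≈0-cancelˡ : ∀ {c x} → p ∤ c → c * x ≈ 0 → x ≈ 0
  ≈0-cancelˡ {c} {x} p∤c cx≈0 =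
    [ flip contradiction p∤c , ∣⇒≈0 ]′ (euclidsLemma c x p-prime (≈0⇒∣ cx≈0))

  frobenius : ∀ x → (x + 1) ^ p ≈ x ^ p + 1
  frobenius x = begin
    (x + 1) ^ p                                               ≡⟨ binomial-theorem p x 1 ⟩
    term Fin.zero + ∑[ i < p ] term (Fin.suc i)
      ≡⟨ cong (term Fin.zero +_) (sum-init-last (term ∘ Fin.suc)) ⟩
    term Fin.zero + (∑[ i < p-1 ] term (Fin.suc (inject₁ i)) + term (Fin.suc (fromℕ p-1)))
      ≈⟨ +-cong (≡⇒≈ first) (+-cong (sum-≈0 middle) (≡⇒≈ last)) ⟩
    1 + (0 + x ^ p)                                           ≡⟨ +-comm 1 (x ^ p) ⟩
    x ^ p + 1                                                 ∎
    where
    open ≈-Reasoning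
    term : Fin (suc p) → ℕ
    term i = (p C toℕ i) * (x ^ toℕ i * 1 ^ (p ∸ toℕ i))
    first : term Fin.zero ≡ 1
    first = trans (+-identityʳ _) (trans (+-identityʳ _) (^-zeroˡ p))
    last : term (Fin.suc (fromℕ p-1)) ≡ x ^ p
    last rewrite toℕ-fromℕ p-1 | nCn≡1 p | n∸n≡0 p = trans (*-identityˡ _) (*-identityʳ _)
    middle : ∀ i → term (Fin.suc (inject₁ i)) ≈ 0
    middle i = ∣⇒≈0 (∣m⇒∣m*n _ (prime-∣-C p-prime (s≤s z≤n) (s≤s i<p-1)))
      where
      i<p-1 : toℕ (inject₁ i) < p-1
      i<p-1 = subst (_< p-1) (sym (toℕ-inject₁ i)) (toℕ<n i)

  x^p≈x : ∀ x → x ^ p ≈ x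
  x^p≈x zero    = ≈-refl
  x^p≈x (suc x) = begin
    suc x ^ p      ≡⟨ cong (_^ p) (+-comm 1 x) ⟩
    (x + 1) ^ p    ≈⟨ frobenius x ⟩
    x ^ p + 1      ≈⟨ +-cong (x^p≈x x) ≈-refl ⟩
    x + 1          ≡⟨ +-comm x 1 ⟩
    suc x          ∎
    where open ≈-Reasoning

  fermat : ∀ {x} → p ∤ x → x ^ p-1 ≈ 1
  fermat {x} p∤x = *-cancelˡ (prime∤⇒coprime p∤x) (begin
    x * x ^ p-1   ≈⟨ x^p≈x x ⟩
    x             ≡⟨ *-identityʳ x ⟨
    x * 1         ∎)
    where open ≈-Reasoning

  x^[i*p-1]≈1 : ∀ {x} → p ∤ x → ∀ i → x ^ (i * p-1) ≈ 1
  x^[i*p-1]≈1     p∤x zero    = ≈-refl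
  x^[i*p-1]≈1 {x} p∤x (suc i) = begin
    x ^ (p-1 + i * p-1)        ≡⟨ ^-distribˡ-+-* x p-1 (i * p-1) ⟩
    x ^ p-1 * x ^ (i * p-1)    ≈⟨ *-cong (fermat p∤x) (x^[i*p-1]≈1 p∤x i) ⟩
    1                          ∎
    where open ≈-Reasoning

  x^[1+e+i*p-1]≈x^[1+e] : ∀ x e i → x ^ (suc e + i * p-1) ≈ x ^ suc e
  x^[1+e+i*p-1]≈x^[1+e] x e i with p ∣? x
  ... | yes p∣x = ≈-trans (x^[1+f]≈0 (e + i * p-1)) (≈-sym (x^[1+f]≈0 e))
    where
    x^[1+f]≈0 : ∀ f → x ^ suc f ≈ 0
    x^[1+f]≈0 f = ∣⇒≈0 (∣m⇒∣m*n (x ^ f) p∣x)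
  ... | no p∤x = begin
    x ^ (suc e + i * p-1)          ≡⟨ ^-distribˡ-+-* x (suc e) (i * p-1) ⟩
    x ^ suc e * x ^ (i * p-1)      ≈⟨ *-cong (≈-refl {x ^ suc e}) (x^[i*p-1]≈1 p∤x i) ⟩
    x ^ suc e * 1                  ≡⟨ *-identityʳ _ ⟩
    x ^ suc e                      ∎
    where open ≈-Reasoning

  x^m≈x^[m%p-1] : ∀ x {m} → p-1 ∤ m → x ^ m ≈ x ^ (m % p-1)
  x^m≈x^[m%p-1] x {m} p-1∤m with m % p-1 in m%p-1≡
  ... | zero  = contradiction (m%n≡0⇒n∣m m p-1 m%p-1≡) p-1∤m
  ... | suc e = subst (λ m′ → x ^ m′ ≈ x ^ suc e) m≡ (x^[1+e+i*p-1]≈x^[1+e] x e (m / p-1))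
    where
    m≡ : suc e + m / p-1 * p-1 ≡ m
    m≡ = trans (cong (_+ m / p-1 * p-1) (sym m%p-1≡)) (sym (m≡m%n+[m/n]*n m p-1))

  x^m≈x^[1+[m∸1]%p-1] : ∀ x {m} → 1 ≤ m → x ^ m ≈ x ^ suc ((m ∸ 1) % p-1)
  x^m≈x^[1+[m∸1]%p-1] x {suc m} _ = subst (λ m′ → x ^ suc m′ ≈ x ^ suc (m % p-1))
    (sym (m≡m%n+[m/n]*n m p-1)) (x^[1+e+i*p-1]≈x^[1+e] x (m % p-1) (m / p-1))

  powerSum : ℕ → ℕ
  powerSum m = ∑[ x < p ] (toℕ x ^ m)

  ∑[x+1]^m≡powerSum+p^m : ∀ m → .{{NonZero m}} → ∑[ x < p ] (suc (toℕ x) ^ m) ≡ powerSum m + p ^ m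
  ∑[x+1]^m≡powerSum+p^m m@(suc _) = begin
    ∑[ x ≤ p ] (toℕ x ^ m)                                ≡⟨ sum-init-last {p} (λ x → toℕ x ^ m) ⟩
    ∑[ x < p ] (toℕ (inject₁ x) ^ m) + toℕ (fromℕ p) ^ m  ≡⟨ cong₂ _+_ (sum-cong-≗ {p} (cong (_^ m) ∘ toℕ-inject₁))
                                                                        (cong (_^ m) (toℕ-fromℕ p)) ⟩
    powerSum m + p ^ m                                    ∎
    where open ≡-Reasoning

  powerSum-recurrence : ∀ m → .{{NonZero m}} → ∑[ i < m ] ((m C toℕ i) * powerSum (toℕ i)) ≡ p ^ m
  powerSum-recurrence m = +-cancelʳ-≡ (powerSum m) _ _ (begin
    ∑[ i < m ] ((m C toℕ i) * powerSum (toℕ i)) + powerSum m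
      ≡⟨ cong₂ _+_ (sum-cong-≗ {m} (cong (λ j → (m C j) * powerSum j) ∘ sym ∘ toℕ-inject₁)) (sym term-last) ⟩
    ∑[ i < m ] term (inject₁ i) + term (fromℕ m)        ≡⟨ sum-init-last term ⟨
    ∑[ i ≤ m ] term i
      ≡⟨ sum-cong-≗ {suc m} (λ i → *-distribˡ-sum {p} (m C toℕ i) (power i)) ⟩
    ∑[ i ≤ m ] ∑[ x < p ] ((m C toℕ i) * power i x)      ≡⟨ ∑-comm {suc m} {p} (λ i x → (m C toℕ i) * power i x) ⟩
    ∑[ x < p ] ∑[ i ≤ m ] ((m C toℕ i) * power i x)      ≡⟨ sum-cong-≗ {p} (sym ∘ expand ∘ toℕ) ⟩
    ∑[ x < p ] (suc (toℕ x) ^ m)                         ≡⟨ ∑[x+1]^m≡powerSum+p^m m ⟩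
    powerSum m + p ^ m                                  ≡⟨ +-comm (powerSum m) (p ^ m) ⟩
    p ^ m + powerSum m                                  ∎)
    where
    open ≡-Reasoning
    term : Fin (suc m) → ℕ
    term i = (m C toℕ i) * powerSum (toℕ i)
    power : Fin (suc m) → Fin p → ℕ
    power i x = toℕ x ^ toℕ i
    term-last : term (fromℕ m) ≡ powerSum m
    term-last rewrite toℕ-fromℕ m | nCn≡1 m = *-identityˡ _
    expand : ∀ x → suc x ^ m ≡ ∑[ i ≤ m ] ((m C toℕ i) * x ^ toℕ i)
    expand x = begin
      suc x ^ m                                                ≡⟨ cong (_^ m) (+-comm 1 x) ⟩
      (x + 1) ^ m                                              ≡⟨ binomial-theorem m x 1 ⟩
      ∑[ i ≤ m ] ((m C toℕ i) * (x ^ toℕ i * 1 ^ (m ∸ toℕ i)))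
                   ≡⟨ sum-cong-≗ {suc m} (λ i → cong ((m C toℕ i) *_) (drop-1^ i)) ⟩
      ∑[ i ≤ m ] ((m C toℕ i) * x ^ toℕ i)                     ∎
      where
      drop-1^ : ∀ i → x ^ toℕ i * 1 ^ (m ∸ toℕ i) ≡ x ^ toℕ i
      drop-1^ i = trans (cong (x ^ toℕ i *_) (^-zeroˡ (m ∸ toℕ i))) (*-identityʳ (x ^ toℕ i))

  powerSum0≈0 : powerSum 0 ≈ 0
  powerSum0≈0 = ∣⇒≈0 (subst (p ∣_) (sym (∑1≡n p)) ∣-refl)

  powerSum≈0 : ∀ {m} → 0 < m → m < p-1 → powerSum m ≈ 0
  powerSum≈0 {suc s} _ = <-rec _ step s
    where
    step : ∀ s → (∀ {r} → r < s → suc r < p-1 → powerSum (suc r) ≈ 0) → suc s < p-1 → powerSum (suc s) ≈ 0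
    step s rec s+1<p-1 = ≈0-cancelˡ (>⇒∤ (s≤s s+1<p-1)) (begin
      m * powerSum (suc s)                                  ≡⟨ term-last ⟨
      term (fromℕ (suc s))                                  ≈⟨ +-cong (≈-sym init≈0) (≈-refl {term (fromℕ (suc s))}) ⟩
      ∑[ i < suc s ] term (inject₁ i) + term (fromℕ (suc s)) ≡⟨ sum-init-last term ⟨
      ∑[ i < m ] term i                                     ≡⟨ powerSum-recurrence m ⟩
      p ^ m                                                 ≈⟨ ∣⇒≈0 (m∣m*n (p ^ suc s)) ⟩
      0                                                     ∎)
      where
      open ≈-Reasoning
      m : ℕ
      m = suc (suc s)
      term : Fin m → ℕ
      term i = (m C toℕ i) * powerSum (toℕ i)
      lower : ∀ i → i < suc s → powerSum i ≈ 0
      lower zero    _       = powerSum0≈0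
      lower (suc i) i+1<s+1 = rec (s≤s⁻¹ i+1<s+1) (<-trans (s≤s (s≤s⁻¹ i+1<s+1)) s+1<p-1)
      init≈0 : ∑[ i < suc s ] term (inject₁ i) ≈ 0
      init≈0 = sum-≈0 λ i → *-zeroʳ-≈ (m C toℕ (inject₁ i))
        (lower (toℕ (inject₁ i)) (subst (_< suc s) (sym (toℕ-inject₁ i)) (toℕ<n i)))
      m-C-[m∸1]≡m : m C suc s ≡ m
      m-C-[m∸1]≡m = trans (nCk≡nC[n∸k] (n≤1+n (suc s))) (trans (cong (m C_) (m+n∸n≡m 1 (suc s))) (nC1≡n m))
      term-last : term (fromℕ (suc s)) ≡ m * powerSum (suc s)
      term-last rewrite toℕ-fromℕ s = cong (_* powerSum (suc s)) m-C-[m∸1]≡m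

  powerSum≈0-nonmultiple : ∀ {m} → p-1 ∤ m → powerSum m ≈ 0
  powerSum≈0-nonmultiple {m} p-1∤m = ≈-trans (sum-cong {p} (λ x → x^m≈x^[m%p-1] (toℕ x) p-1∤m))
    (powerSum≈0 (n≢0⇒n>0 (p-1∤m ∘ m%n≡0⇒n∣m m p-1)) (m%n<n m p-1))

  powerSum≈p-1 : ∀ {m} → .{{NonZero m}} → p-1 ∣ m → powerSum m ≈ p-1
  powerSum≈p-1 {m@(suc _)} (divides i m≡i*p-1) = begin
    ∑[ x < p-1 ] (suc (toℕ x) ^ m)  ≈⟨ sum-cong (λ x → subst (λ e → suc (toℕ x) ^ e ≈ 1) (sym m≡i*p-1)
                                                          (x^[i*p-1]≈1 (>⇒∤ (s≤s (toℕ<n x))) i)) ⟩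
    ∑[ x < p-1 ] 1                  ≡⟨ ∑1≡n p-1 ⟩
    p-1                             ∎
    where open ≈-Reasoning

  powerSum-permutation : ∀ (F : ℕ → ℕ) {f : Fin p → Fin p} → IsPermPoly p f →
                         (∀ c → toℕ (f c) ≡ F (toℕ c) % p) → ∀ t → ∑[ x < p ] (F (toℕ x) ^ t) ≈ powerSum t
  powerSum-permutation F {f} perm f≡F t = begin
    ∑[ x < p ] (F (toℕ x) ^ t)        ≈⟨ sum-cong {p} (λ x → ^-cong t (≈-sym (x%m≈x (F (toℕ x))))) ⟩
    ∑[ x < p ] ((F (toℕ x) % p) ^ t)  ≡⟨ sum-cong-≗ {p} (cong (_^ t) ∘ f≡F) ⟨
    ∑[ x < p ] (toℕ (f x) ^ t)        ≡⟨ ∑-bijection perm (λ y → toℕ y ^ t) ⟩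
    powerSum t                        ∎
    where open ≈-Reasoning

  unique-solution⇒¬permutation : ∀ {n k} (a : Fin p) → 1 ≤ n → toℕ a ≢ 0 → UniqueSolution p-1 n k →
                                 ¬ IsPermPoly p (evalBinom p n k a)
  unique-solution⇒¬permutation {n} {k} a 1≤n a≢0 sol perm =
    prime-∤-* p-prime (prime-∤-C p-prime j₀≤t (<-trans t<m (n<1+n p-1)))
                      (prime-∤-* p-prime (prime-∤-^ p-prime (t ∸ j₀) p∤A) (>⇒∤ (n<1+n p-1)))
                      (≈0⇒∣ leading≈0)
    where
    open UniqueSolution sol
    A : ℕ
    A = toℕ a
    p∤A : p ∤ A
    p∤A = >⇒∤ {{≢-nonZero a≢0}} (toℕ<n a)
    F : ℕ → ℕ
    F x = x ^ (n + k) + A * x ^ n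
    term : ℕ → ℕ
    term j = (t C j) * (A ^ (t ∸ j) * powerSum (n * t + k * j))
    j₀′ : Fin (suc t)
    j₀′ = fromℕ< (s≤s j₀≤t)
    others≈0 : ∀ j → j ≢ j₀′ → term (toℕ j) ≈ 0
    others≈0 j j≢j₀′ =
      *-zeroʳ-≈ (t C toℕ j) (*-zeroʳ-≈ (A ^ (t ∸ toℕ j)) (powerSum≈0-nonmultiple not-solution))
      where
      not-solution : p-1 ∤ n * t + k * toℕ j
      not-solution p-1∣ = j≢j₀′ (toℕ-injective (trans (unique (toℕ j) (s≤s⁻¹ (toℕ<n j)) p-1∣)
                                                      (sym (toℕ-fromℕ< (s≤s j₀≤t)))))
    leading≈0 : (t C j₀) * (A ^ (t ∸ j₀) * p-1) ≈ 0
    leading≈0 = begin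
      (t C j₀) * (A ^ (t ∸ j₀) * p-1)          ≈⟨ *-cong (≈-refl {t C j₀}) (*-cong (≈-refl {A ^ (t ∸ j₀)})
                                                     (powerSum≈p-1 {{E₀-nonZero}} solution)) ⟨
      term j₀                                  ≡⟨ cong term (toℕ-fromℕ< (s≤s j₀≤t)) ⟨
      term (toℕ j₀′)                           ≈⟨ sum-single {t} (term ∘ toℕ) j₀′ others≈0 ⟨
      ∑[ j ≤ t ] term (toℕ j)                  ≡⟨ sum-cong-≗ {suc t} distribute ⟩
      ∑[ j ≤ t ] ∑[ x < p ] summand j x        ≡⟨ ∑-comm {suc t} {p} summand ⟩
      ∑[ x < p ] ∑[ j ≤ t ] summand j x        ≡⟨ sum-cong-≗ {p} ([x^[n+k]+a*x^n]^t≡∑ n k A t ∘ toℕ) ⟨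
      ∑[ x < p ] (F (toℕ x) ^ t)               ≈⟨ powerSum-permutation F perm (λ c → toℕ-fromℕ< _) t ⟩
      powerSum t                               ≈⟨ powerSum≈0 1≤t t<m ⟩
      0                                        ∎
      where
      open ≈-Reasoning
      power : Fin (suc t) → Fin p → ℕ
      power j x = toℕ x ^ (n * t + k * toℕ j)
      summand : Fin (suc t) → Fin p → ℕ
      summand j x = (t C toℕ j) * (A ^ (t ∸ toℕ j) * power j x)
      distribute : ∀ j → term (toℕ j) ≡ ∑[ x < p ] summand j x
      distribute j = trans (cong ((t C toℕ j) *_) (*-distribˡ-sum {p} (A ^ (t ∸ toℕ j)) (power j)))
                           (*-distribˡ-sum {p} (t C toℕ j) (λ x → A ^ (t ∸ toℕ j) * power j x))
      E₀-nonZero : NonZero (n * t + k * j₀)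
      E₀-nonZero = >-nonZero (≤-trans (*-mono-≤ 1≤n 1≤t) (m≤m+n (n * t) (k * j₀)))

  evalBinom-reduce : ∀ {n k} (a : Fin p) → 1 ≤ n → p-1 ∤ k →
                     evalBinom p n k a ≗ evalBinom p (suc ((n ∸ 1) % p-1)) (k % p-1) a
  evalBinom-reduce {n} {k} a 1≤n p-1∤k c = toℕ-injective (begin
    toℕ (evalBinom p n k a c)          ≡⟨ toℕ-fromℕ< _ ⟩
    (x ^ (n + k) + A * x ^ n) % p      ≡⟨ %-≡ (+-cong x^[n+k]≈x^[N+K] (*-cong (≈-refl {A}) x^n≈x^N)) ⟩
    (x ^ (N + K) + A * x ^ N) % p      ≡⟨ toℕ-fromℕ< _ ⟨
    toℕ (evalBinom p N K a c)          ∎)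
    where
    open ≡-Reasoning
    x A N K : ℕ
    x = toℕ c
    A = toℕ a
    N = suc ((n ∸ 1) % p-1)
    K = k % p-1
    x^n≈x^N : x ^ n ≈ x ^ N
    x^n≈x^N = x^m≈x^[1+[m∸1]%p-1] x 1≤n
    x^[n+k]≈x^[N+K] : x ^ (n + k) ≈ x ^ (N + K)
    x^[n+k]≈x^[N+K] = ≈-trans (≡⇒≈ (^-distribˡ-+-* x n k))
      (≈-trans (*-cong x^n≈x^N (x^m≈x^[m%p-1] x p-1∤k)) (≡⇒≈ (sym (^-distribˡ-+-* x N K))))

  reduced-collisions⇒¬permutation : ReducedCollisions p-1 → ∀ {n k} (a : Fin p) → 1 ≤ n → toℕ a ≢ 0 →
                                    p-1 ∤ k → gcd k p-1 ≡ 4 → ¬ IsPermPoly p (evalBinom p n k a)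
  reduced-collisions⇒¬permutation collisions {n} {k} a 1≤n a≢0 p-1∤k gcd≡4 =
    collision⇒¬bijective (evalBinom-reduce a 1≤n p-1∤k)
      (subst₂ (λ N K → Collision (evalBinom p (suc N) K a)) toℕ[[n∸1]mod] toℕ[k-mod]
        (collisions ((n ∸ 1) mod p-1) (k mod p-1) a gcd[K,p-1]≡4 a≢0))
    where
    toℕ[[n∸1]mod] : toℕ ((n ∸ 1) mod p-1) ≡ (n ∸ 1) % p-1
    toℕ[[n∸1]mod] = toℕ-fromℕ< (m%n<n (n ∸ 1) p-1)
    toℕ[k-mod] : toℕ (k mod p-1) ≡ k % p-1
    toℕ[k-mod] = toℕ-fromℕ< (m%n<n k p-1)
    gcd[K,p-1]≡4 : gcd (toℕ (k mod p-1)) p-1 ≡ 4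
    gcd[K,p-1]≡4 = trans (cong (λ K → gcd K p-1) toℕ[k-mod]) (trans (gcd[m%n,n]≡gcd[m,n] k p-1) gcd≡4)

crossing : ∀ {P : ℕ → Set} → Decidable P → ∀ u → P (suc u) → ∃ λ v → v ≤ u × P (suc v) × (v ≡ 0 ⊎ ¬ P v)
crossing P? zero    P1   = 0 , z≤n , P1 , inj₁ refl
crossing P? (suc u) Pu+2 with P? (suc u)
... | yes Pu+1 = let v , v≤u , Pv+1 , onset = crossing P? u Pu+1 in v , m≤n⇒m≤1+n v≤u , Pv+1 , onset
... | no ¬Pu+1 = suc u , ≤-refl , Pu+2 , inj₂ ¬Pu+1

%-+-≤ : ∀ x y e .{{_ : NonZero e}} → x % e + y % e ≤ (x + y) % e + e
%-+-≤ x y e = begin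
  c                   ≡⟨ m≡m%n+[m/n]*n c e ⟩
  c % e + c / e * e   ≤⟨ +-monoʳ-≤ (c % e) (*-monoˡ-≤ e c/e≤1) ⟩
  c % e + 1 * e       ≡⟨ cong₂ _+_ (sym (%-distribˡ-+ x y e)) (*-identityˡ e) ⟩
  (x + y) % e + e     ∎
  where
  open ≤-Reasoning
  c : ℕ
  c = x % e + y % e
  c<2*e : c < 2 * e
  c<2*e = subst (c <_) (cong (e +_) (sym (+-identityʳ e))) (+-mono-< (m%n<n x e) (m%n<n y e))
  c/e≤1 : c / e ≤ 1
  c/e≤1 = s≤s⁻¹ (m<n*o⇒m/o<n c<2*e)

coprime⇒∃r[e∣n+k*r] : ∀ {k e} .{{_ : NonZero e}} → Coprime k e → ∀ n → ∃ λ r → e ∣ n + k * r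
coprime⇒∃r[e∣n+k*r] {k} {e@(suc e-1)} coprime n with coprime-Bézout coprime
... | Bézout.-+ x y 1+x*k≡y*e = n * x , divides (n * y) (begin
  n + k * (n * x)             ≡⟨ solve (n ∷ k ∷ x ∷ []) ⟩
  n * (1 + x * k)             ≡⟨ cong (n *_) 1+x*k≡y*e ⟩
  n * (y * e)                 ≡⟨ *-assoc n y e ⟨
  n * y * e                   ∎)
  where open ≡-Reasoning
... | Bézout.+- x y 1+y*e≡x*k = n * x * e-1 , divides (n + n * y * e-1) (begin
  n + k * (n * x * e-1)       ≡⟨ solve (n ∷ k ∷ x ∷ e-1 ∷ []) ⟩
  n + n * e-1 * (x * k)       ≡⟨ cong (λ z → n + n * e-1 * z) 1+y*e≡x*k ⟨
  n + n * e-1 * (1 + y * e)   ≡⟨ solve (n ∷ y ∷ e-1 ∷ []) ⟩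
  (n + n * y * e-1) * e       ∎)
  where open ≡-Reasoning

[n*[d*s]+k*d*j]≡[s*n+k*j]*d : ∀ n d s k j → n * (d * s) + k * d * j ≡ (s * n + k * j) * d
[n*[d*s]+k*d*j]≡[s*n+k*j]*d n d s k j = solve (n ∷ d ∷ s ∷ k ∷ j ∷ [])

module _ {d e k₁ : ℕ} (n : ℕ) .{{_ : NonZero d}} (d<e : d < e) (coprime : Coprime k₁ e) where

  private
    0<d : 0 < d
    0<d = >-nonZero⁻¹ d

    2≤e : 2 ≤ e
    2≤e = ≤-trans (s≤s 0<d) d<e

    instance
      e-nonZero : NonZero e
      e-nonZero = >-nonZero (<-trans 0<d d<e)

    open Modulo e

    r : ℕ
    r = proj₁ (coprime⇒∃r[e∣n+k*r] coprime n)

    s*n+k₁*[s*r]≈0 : ∀ s → s * n + k₁ * (s * r) ≈ 0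
    s*n+k₁*[s*r]≈0 s = ∣⇒≈0 (subst (e ∣_) distrib (∣n⇒∣m*n s (proj₂ (coprime⇒∃r[e∣n+k*r] coprime n))))
      where
      distrib : s * (n + k₁ * r) ≡ s * n + k₁ * (s * r)
      distrib = trans (*-distribˡ-+ s n (k₁ * r)) (cong (s * n +_) (x∙yz≈y∙xz s k₁ r))

    solution⇒≈ : ∀ s j → e ∣ s * n + k₁ * j → j ≈ s * r
    solution⇒≈ s j e∣ = *-cancelˡ (Coprimality.sym coprime)
                          (+-cancelˡ (s * n) (≈-trans (∣⇒≈0 e∣) (≈-sym (s*n+k₁*[s*r]≈0 s))))

    ≈⇒solution : ∀ s j → j ≈ s * r → e ∣ s * n + k₁ * j
    ≈⇒solution s j j≈s*r =
      ≈0⇒∣ (≈-trans (+-cong (≈-refl {s * n}) (*-cong (≈-refl {k₁}) j≈s*r)) (s*n+k₁*[s*r]≈0 s))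

    root : ℕ → ℕ
    root s = (s * r) % e

    window⇒unique-solution : ∀ {s} → 1 ≤ s → s < e → root s ≤ d * s → d * s < root s + e →
                             UniqueSolution (e * d) n (k₁ * d)
    window⇒unique-solution {s} 1≤s s<e root≤ds ds<root+e = record
      { t        = d * s
      ; j₀       = root s
      ; 1≤t      = *-mono-≤ 0<d 1≤s
      ; t<m      = subst (d * s <_) (*-comm d e) (*-monoʳ-< d s<e)
      ; j₀≤t     = root≤ds
      ; solution = scale (≈⇒solution s (root s) (x%m≈x (s * r)))
      ; unique   = λ j j≤ds e*d∣ → ≈⇒≡ (≈-trans (solution⇒≈ s j (unscale e*d∣)) (≈-sym (x%m≈x (s * r))))
                                       (m%n<n (s * r) e) (≤-<-trans j≤ds ds<root+e)
      }
      where
      scale : ∀ {j} → e ∣ s * n + k₁ * j → e * d ∣ n * (d * s) + k₁ * d * j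
      scale {j} e∣ = subst (e * d ∣_) (sym ([n*[d*s]+k*d*j]≡[s*n+k*j]*d n d s k₁ j)) (*-monoˡ-∣ d e∣)
      unscale : ∀ {j} → e * d ∣ n * (d * s) + k₁ * d * j → e ∣ s * n + k₁ * j
      unscale {j} e*d∣ = *-cancelʳ-∣ d (subst (e * d ∣_) ([n*[d*s]+k*d*j]≡[s*n+k*j]*d n d s k₁ j) e*d∣)

    e≡2+[e∸2] : suc (suc (e ∸ 2)) ≡ e
    e≡2+[e∸2] = m+[n∸m]≡n 2≤e

    root[e∸1]≤d*[e∸1] : root (suc (e ∸ 2)) ≤ d * suc (e ∸ 2)
    root[e∸1]≤d*[e∸1] = ≤-trans (s≤s⁻¹ (subst (root (suc (e ∸ 2)) <_) (sym e≡2+[e∸2]) (m%n<n _ e))) (m≤n*m _ d)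

    -- Descend from s = e − 1 to the first s with d (s − 1) < root (s − 1). Since
    -- root s + e ≥ root (s − 1) + root 1, also d s < root s + e there, unless root 1 ≤ d, when s = 1 works.
    window-exists : ∃ λ s → 1 ≤ s × s < e × root s ≤ d * s × d * s < root s + e
    window-exists with crossing (λ s → root s ≤? d * s) (e ∸ 2) root[e∸1]≤d*[e∸1]
    ... | v , v≤e∸2 , root[v+1]≤ , onset with root 1 ≤? d * 1
    ...   | yes root1≤d = 1 , ≤-refl , ≤-trans (s≤s 0<d) d<e , root1≤d , d*1<root1+e
      where
      d*1<root1+e : d * 1 < root 1 + e
      d*1<root1+e = subst (_< root 1 + e) (sym (*-identityʳ d)) (<-≤-trans d<e (m≤n+m e (root 1)))
    ...   | no root1≰d with onset
    ...     | inj₁ refl      = contradiction root[v+1]≤ root1≰d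
    ...     | inj₂ rootv≰d*v = suc v , s≤s z≤n , v+1<e , root[v+1]≤ , d*[v+1]<root[v+1]+e
      where
      open ≤-Reasoning
      v+1<e : suc v < e
      v+1<e = subst (suc v <_) e≡2+[e∸2] (s≤s (s≤s v≤e∸2))
      d*[v+1]<root[v+1]+e : d * suc v < root (suc v) + e
      d*[v+1]<root[v+1]+e = begin-strict
        d * suc v             ≡⟨ *-suc d v ⟩
        d + d * v             <⟨ +-mono-< (subst (_< root 1) (*-identityʳ d) (≰⇒> root1≰d)) (≰⇒> rootv≰d*v) ⟩
        root 1 + root v       ≡⟨ cong (λ x → x % e + root v) (*-identityˡ r) ⟩
        r % e + (v * r) % e   ≤⟨ %-+-≤ r (v * r) e ⟩
        root (suc v) + e      ∎

  coprime⇒unique-solution : UniqueSolution (e * d) n (k₁ * d)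
  coprime⇒unique-solution =
    let s , 1≤s , s<e , root≤ds , ds<root+e = window-exists in window⇒unique-solution 1≤s s<e root≤ds ds<root+e

gcd[m*d,n*d]≡d⇒coprime : ∀ {m n d} .{{_ : NonZero d}} → gcd (m * d) (n * d) ≡ d → Coprime m n
gcd[m*d,n*d]≡d⇒coprime {m} {n} {d} gcd≡d = gcd≡1⇒coprime (*-cancelˡ-≡ (gcd m n) 1 d (begin
  d * gcd m n           ≡⟨ c*gcd[m,n]≡gcd[cm,cn] d m n ⟩
  gcd (d * m) (d * n)   ≡⟨ cong₂ gcd (*-comm d m) (*-comm d n) ⟩
  gcd (m * d) (n * d)   ≡⟨ gcd≡d ⟩
  d                     ≡⟨ *-identityʳ d ⟨
  d * 1                 ∎))
  where open ≡-Reasoning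

reducedCollisions[12] : ReducedCollisions 12
reducedCollisions[12] = toWitness {a? = reducedCollisions? 12} _

reducedCollisions[16] : ReducedCollisions 16
reducedCollisions[16] = toWitness {a? = reducedCollisions? 16} _

gcd≡4⇒¬permutation : ∀ e {n k₁} → Prime (suc (e * 4)) → (a : Fin (suc (e * 4))) → 1 ≤ n → toℕ a ≢ 0 →
                     e * 4 ∤ k₁ * 4 → gcd (k₁ * 4) (e * 4) ≡ 4 →
                     ¬ IsPermPoly (suc (e * 4)) (evalBinom (suc (e * 4)) n (k₁ * 4) a)
gcd≡4⇒¬permutation 0 p-prime _ _ _ _ _ =
  contradiction (nonTrivial⇒n>1 1 {{prime⇒nonTrivial p-prime}}) (<-irrefl refl)
gcd≡4⇒¬permutation 1 {k₁ = k₁} _ _ _ _ 4∤k _ = contradiction (divides k₁ refl) 4∤k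
gcd≡4⇒¬permutation 2 p-prime _ _ _ _ _ =
  contradiction (composite-≢ 3 (λ ()) (divides 3 refl)) (prime⇒¬composite p-prime)
gcd≡4⇒¬permutation 3 p-prime a 1≤n a≢0 12∤k gcd≡4 =
  PrimeField.reduced-collisions⇒¬permutation p-prime reducedCollisions[12] a 1≤n a≢0 12∤k gcd≡4
gcd≡4⇒¬permutation 4 p-prime a 1≤n a≢0 16∤k gcd≡4 =
  PrimeField.reduced-collisions⇒¬permutation p-prime reducedCollisions[16] a 1≤n a≢0 16∤k gcd≡4
gcd≡4⇒¬permutation e@(suc (suc (suc (suc (suc _))))) {n} {k₁} p-prime a 1≤n a≢0 _ gcd≡4 =
  PrimeField.unique-solution⇒¬permutation p-prime a 1≤n a≢0
    (coprime⇒unique-solution {d = 4} {e = e} n 4<e (gcd[m*d,n*d]≡d⇒coprime {k₁} {e} {4} gcd≡4))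
  where
  4<e : 4 < e
  4<e = s≤s (s≤s (s≤s (s≤s (s≤s z≤n))))

theorem3p2 : (p : ℕ) .{{_ : NonZero p}} → Prime p → (n k : ℕ) → n ≥ 1 → k ≥ 1 →
    (a : Fin p) → NontrivialPermBinom p n k a → ¬ (gcd k (p ∸ 1) ≡ 4)
-- The hypothesis k ≥ 1 is implied by (p − 1) ∤ k.
theorem3p2 (suc p-1) p-prime n k 1≤n _ a (a≢0 , p-1∤k , perm) gcd≡4
  with divides e refl ← subst (_∣ p-1) gcd≡4 (gcd[m,n]∣n k p-1)
  with divides k₁ refl ← subst (_∣ k) gcd≡4 (gcd[m,n]∣m k p-1)
  = gcd≡4⇒¬permutation e {n} {k₁} p-prime a 1≤n a≢0 p-1∤k gcd≡4 perm
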